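{- Let $\mathcal{H}$ be a semiselective coideal, let $B\in\mathcal{H}$, and let $f:\mathcal{H}\upharpoonright B\to\mathbb{N}$ and $g:\mathcal{H}\upharpoonright B\to\mathcal{H}\upharpoonright B$ be functions such that $f(A)\in A$ and $g(A)\subseteq A/f(A)$ for all $A\in\mathcal{H}\upharpoonright B$. Then there is $E\in\mathcal{H}\upharpoonright B$ such that for each $p\in E$ there exists $A\in\mathcal{H}\upharpoonright B$ with $f(A)=p$ and $E/p\subseteq g(A)$.
   Context: $\mathbb{N}=\{0,1,2,\dots\}$; $A/n=\{m\in A:m>n\}$. A coideal is $\mathcal{H}\subseteq\wp(\mathbb{N})$, $\mathcal{H}\neq\wp(\mathbb{N})$, upward closed and with $A\cup B\in\mathcal{H}\Rightarrow A\in\mathcal{H}$ or $B\in\mathcal{H}$. $\mathcal{H}\upharpoonright A=\{C\in\mathcal{H}:C\subseteq A\}$. $D\subseteq\mathcal{H}$ is dense open in $(\mathcal{H},\subseteq)$ if every element of $\mathcal{H}$ has a subset in $D$ and $D$ is closed under subsets lying in $\mathcal{H}$. $\mathcal{H}$ is semiselective if for every sequence $(D_n)_n$ of dense open subsets of $(\mathcal{H},\subseteq)$ and every $A\in\mathcal{H}$ there is $C\in\mathcal{H}\upharpoonright A$ with $C/n\in D_n$ for all $n\in C$. -}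

module Defs where

open import Level using (0ℓ)
open import Data.Nat using (ℕ; _<_)
open import Data.Product using (Σ; _×_; ∃; ∃-syntax)
open import Data.Sum using (_⊎_)
open import Relation.Nullary using (¬_)

Subset : Set₁
Subset = ℕ → Set

Family : Set₁
Family = Subset → Set

_⊆_ : Subset → Subset → Set
A ⊆ B = ∀ n → A n → B n

_∪_ : Subset → Subset → Subset
(A ∪ B) n = A n ⊎ B n

_/_ : Subset → ℕ → Subset
(A / n) m = A m × n < m

_∈_↾_ : Subset → Family → Subset → Set
C ∈ H ↾ A = H C × C ⊆ A

record IsCoideal (H : Family) : Set₁ where
  field
    proper       : ∃[ A ] ¬ H A
    upward       : ∀ A B → A ⊆ B → H A → H B
    union-split  : ∀ A B → H (A ∪ B) → H A ⊎ H B

record IsDenseOpen (H : Family) (D : Family) : Set₁ where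
  field
    sub     : ∀ C → D C → H C
    dense   : ∀ A → H A → ∃[ C ] (C ⊆ A × D C)
    open'   : ∀ C C′ → D C → C′ ⊆ C → H C′ → D C′

IsSemiselective : Family → Set₁
IsSemiselective H =
  (D : ℕ → Family) → (∀ n → IsDenseOpen H (D n)) →
  ∀ A → H A → ∃[ C ] (C ∈ H ↾ A × (∀ n → C n → D n (C / n)))

module Submission where

-- Let Good p C say that C ⊆ g A for some A with f A = p.  Semiselectivity, applied to the
-- dense open sets of those C ∈ H that decide Good p (either satisfy it or have no subset in
-- H that does), yields C ∈ H ↾ B such that each C / p with p ∈ C decides Good p.  Split C into
-- E = {p ∈ C : Good p (C / p)} and Z = C ∖ E.  If Z were in H, then p = f Z ∈ Z and
-- g Z ⊆ C / p would be a subset in H satisfying Good p, so C / p satisfies Good p and p ∈ E,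
-- a contradiction.  Hence E ∈ H because H is a coideal, and E / p ⊆ C / p ⊆ g A for p ∈ E.

open import Defs
open import Level using (0ℓ)
import Level
open import Axiom.ExcludedMiddle using (ExcludedMiddle)
open import Data.Nat using (ℕ)
open import Data.Product using (_×_; ∃; ∃-syntax; _,_; proj₁; proj₂)
open import Data.Sum using (_⊎_; inj₁; inj₂)
open import Data.Empty using (⊥-elim)
open import Relation.Nullary using (¬_; yes; no; contradiction)
open import Relation.Nullary.Decidable using (True; False; toWitness; fromWitness; toWitnessFalse)
open import Relation.Binary.PropositionalEquality using (_≡_; refl)

⊆-refl : ∀ {A} → A ⊆ A
⊆-refl _ a = a

⊆-trans : ∀ {A B C} → A ⊆ B → B ⊆ C → A ⊆ C
⊆-trans A⊆B B⊆C n a = B⊆C n (A⊆B n a)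

/-mono : ∀ {A B} p → A ⊆ B → (A / p) ⊆ (B / p)
/-mono p A⊆B n (a , p<n) = A⊆B n a , p<n

large-part-of-cover : ∀ {H} → IsCoideal H → ∀ {C Z E} → H C → C ⊆ (Z ∪ E) → ¬ H Z → H E
large-part-of-cover coideal {C} {Z} {E} HC C⊆Z∪E ¬HZ
  with IsCoideal.union-split coideal Z E (IsCoideal.upward coideal C (Z ∪ E) C⊆Z∪E HC)
... | inj₁ HZ = contradiction HZ ¬HZ
... | inj₂ HE = HE

module _ (em : ExcludedMiddle (Level.suc 0ℓ)) where

  -- Family and Subset live in Set, while the relevant propositions quantify over subsets;
  -- excluded middle shrinks them to Set through their decision.
  Holds Fails : Set₁ → Set
  Holds P = True (em {P})
  Fails P = False (em {P})

  fails-or-holds : ∀ P → Fails P ⊎ Holds P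
  fails-or-holds P with em {P}
  ... | yes _ = inj₂ _
  ... | no _  = inj₁ _

  Decides : Family → (Subset → Set₁) → Family
  Decides H Q C = Holds (H C × (Q C ⊎ (∀ C′ → C′ ⊆ C → H C′ → ¬ Q C′)))

  decides-dense-open : ∀ H Q → (∀ C C′ → C′ ⊆ C → Q C → Q C′) → IsDenseOpen H (Decides H Q)
  decides-dense-open H Q Q-⊆ = record { sub = sub ; dense = dense ; open' = open' }
    where
    sub : ∀ C → Decides H Q C → H C
    sub C dec = proj₁ (toWitness dec)

    dense : ∀ A → H A → ∃[ C ] (C ⊆ A × Decides H Q C)
    dense A HA with em {∃[ C ] (C ⊆ A × H C × Q C)}
    ... | yes (C , C⊆A , HC , QC) = C , C⊆A , fromWitness (HC , inj₁ QC)
    ... | no ∄C = A , ⊆-refl , fromWitness (HA , inj₂ λ C C⊆A HC QC → ∄C (C , C⊆A , HC , QC))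

    open' : ∀ C C′ → Decides H Q C → C′ ⊆ C → H C′ → Decides H Q C′
    open' C C′ dec C′⊆C HC′ with toWitness dec
    ... | _ , inj₁ QC   = fromWitness (HC′ , inj₁ (Q-⊆ C C′ C′⊆C QC))
    ... | _ , inj₂ ¬Q⊆C = fromWitness (HC′ , inj₂ λ C″ C″⊆C′ → ¬Q⊆C C″ (⊆-trans C″⊆C′ C′⊆C))

  decides-holds : ∀ {H Q C C′} → Decides H Q C → C′ ⊆ C → H C′ → Q C′ → Q C
  decides-holds dec C′⊆C HC′ QC′ with toWitness dec
  ... | _ , inj₁ QC   = QC
  ... | _ , inj₂ ¬Q⊆C = ⊥-elim (¬Q⊆C _ C′⊆C HC′ QC′)

  module Selection {H : Family} (coideal : IsCoideal H) {B : Subset} {f : Subset → ℕ} {g : Subset → Subset}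
           (f∈ : ∀ A → A ∈ H ↾ B → A (f A))
           (g∈ : ∀ A → A ∈ H ↾ B → g A ∈ H ↾ B)
           (g⊆ : ∀ A → A ∈ H ↾ B → g A ⊆ (A / f A)) where

    Good : ℕ → Subset → Set₁
    Good p C = ∃[ A ] (A ∈ H ↾ B × f A ≡ p × C ⊆ g A)

    Good-⊆ : ∀ p C C′ → C′ ⊆ C → Good p C → Good p C′
    Good-⊆ p C C′ C′⊆C (A , A∈ , fA≡p , C⊆gA) = A , A∈ , fA≡p , ⊆-trans C′⊆C C⊆gA

    module Split {C : Subset} (C∈ : C ∈ H ↾ B)
             (C-decides : ∀ p → C p → Decides H (Good p) (C / p)) where

      E Z : Subset
      E p = C p × Holds (Good p (C / p))
      Z p = C p × Fails (Good p (C / p))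

      E⊆B : E ⊆ B
      E⊆B p (c , _) = proj₂ C∈ p c

      Z-small : ¬ H Z
      Z-small HZ = toWitnessFalse ¬good good
        where
        Z∈ : Z ∈ H ↾ B
        Z∈ = HZ , λ p (c , _) → proj₂ C∈ p c

        p = f Z
        Cp = proj₁ (f∈ Z Z∈)
        ¬good = proj₂ (f∈ Z Z∈)

        gZ⊆C/p : g Z ⊆ (C / p)
        gZ⊆C/p = ⊆-trans (g⊆ Z Z∈) (/-mono p λ _ → proj₁)

        good : Good p (C / p)
        good = decides-holds (C-decides p Cp) gZ⊆C/p (proj₁ (g∈ Z Z∈)) (Z , Z∈ , refl , ⊆-refl)

      E-large : H E
      E-large = large-part-of-cover coideal (proj₁ C∈) C⊆Z∪E Z-small
        where
        C⊆Z∪E : C ⊆ (Z ∪ E)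
        C⊆Z∪E p c with fails-or-holds (Good p (C / p))
        ... | inj₁ fails = inj₁ (c , fails)
        ... | inj₂ holds = inj₂ (c , holds)

      E-good : ∀ p → E p → ∃[ A ] (A ∈ H ↾ B × f A ≡ p × (E / p) ⊆ g A)
      E-good p (_ , holds) with toWitness holds
      ... | A , A∈ , fA≡p , C/p⊆gA = A , A∈ , fA≡p , ⊆-trans (/-mono p λ _ → proj₁) C/p⊆gA

lemma4p2 : ExcludedMiddle (Level.suc 0ℓ) →
    (H : Family) → IsCoideal H → IsSemiselective H →
    (B : Subset) → H B →
    (f : Subset → ℕ) (g : Subset → Subset) →
    (∀ A → A ∈ H ↾ B → A (f A)) →
    (∀ A → A ∈ H ↾ B → g A ∈ H ↾ B) →
    (∀ A → A ∈ H ↾ B → g A ⊆ (A / f A)) →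
    ∃[ E ] (E ∈ H ↾ B ×
    (∀ p → E p → ∃[ A ] (A ∈ H ↾ B × f A ≡ p × (E / p) ⊆ g A)))
lemma4p2 em H coideal semiselective B HB f g f∈ g∈ g⊆ = E , (E-large , E⊆B) , E-good
  where
  open Selection em coideal f∈ g∈ g⊆

  selected : ∃[ C ] (C ∈ H ↾ B × (∀ p → C p → Decides em H (Good p) (C / p)))
  selected = semiselective (λ p → Decides em H (Good p))
                           (λ p → decides-dense-open em H (Good p) (Good-⊆ p)) B HB

  open Split (proj₁ (proj₂ selected)) (proj₂ (proj₂ selected))
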